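{- Let $G$ be a signed multidigraph with $n\geq 2$ vertices, let $v$ be a vertex of $G$, and let $r(G,v)$ be obtained by replicating $v$, with new vertex $v^1$. Then \[ I_{j}(r(G,v),X)\subseteq \langle x_{v}+1,x_{v^1}+1, I_{j}(G,X)|_{x_v=-1}\rangle, \] for all $1\leq j \leq n$. Moreover, $I_{j}(r(G,v),X)$ is trivial if and only if $I_{j}(G,X)|_{x_v=-1}$ is trivial.
   Context: $\mathcal{P}$ is a principal ideal domain. A signed multidigraph $G$ is a finite multidigraph with signs $\pm1$ on its arcs; for distinct vertices $u,w$, $m_{uw}$ is the number of arcs from $u$ to $w$ and $\sigma(uw)$ their sign. With one variable $x_u$ per vertex, the generalized Laplacian $L(G,X)$ has diagonal entries $x_u$ and off-diagonal entries $L(G,X)_{uw}=-\sigma(uw)m_{uw}1_{\mathcal P}$. The critical ideal $I_i(G,X)$ is the ideal of $\mathcal P[X]$ generated by all $i\times i$ minors of $L(G,X)$; it is trivial if it equals $\langle 1\rangle$. Replicating $v$ means adding a new vertex $v^1$ (with variable $x_{v^1}$) such that for every vertex $u\neq v$ the arcs between $v^1$ and $u$ (both directions, with multiplicities and signs) are exactly those between $v$ and $u$, and adding one positive arc $vv^1$ and one positive arc $v^1v$; the result is $r(G,v)$. For an ideal $I$, $I|_{x_v=c}$ denotes the ideal generated by the images of its elements under $x_v\mapsto c$, regarded inside the polynomial ring of the larger graph. -}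

module Defs where

open import Level using (Level; _⊔_)
open import Algebra.Bundles using (CommutativeRing)
open import Data.Nat using (ℕ; zero; suc; _<?_)
open import Data.Fin using (Fin; zero; suc; toℕ; fromℕ<; inject₁; punchIn; _≟_)
import Data.Fin as F
open import Data.Sign using (Sign)
import Data.Sign as Sgn
open import Data.Product using (Σ; ∃; _×_; _,_)
open import Data.Sum using (_⊎_)
open import Relation.Nullary using (¬_; yes; no)
open import Relation.Binary.PropositionalEquality using (_≡_)

-- Signed multidigraphs on the vertex set Fin n.
-- m u w = number of arcs from u to w, σ u w = their sign (only
-- meaningful for u ≢ w; diagonal values are never used).

record SignedMultidigraph (n : ℕ) : Set where
  field
    m : Fin n → Fin n → ℕ
    σ : Fin n → Fin n → Sign

open SignedMultidigraph public

-- Vertices of r(G,v): Fin (suc n); vertex u of G is inject₁ u, and the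
-- new vertex v¹ is the last one, F.fromℕ n.  'origin v' sends v¹ to v
-- and every other vertex to itself.
origin : ∀ {n} → Fin n → Fin (suc n) → Fin n
origin {n} v u with toℕ u <? n
... | yes lt = fromℕ< lt
... | no _   = v

-- Replication r(G,v): arcs between v¹ and u (u ≠ v) copy those between v
-- and u; one positive arc v→v¹ and one positive arc v¹→v are added.
replicate : ∀ {n} → SignedMultidigraph n → Fin n → SignedMultidigraph (suc n)
replicate G v = record { m = m′ ; σ = σ′ }
  where
  m′ : _ → _ → ℕ
  m′ u w with origin v u ≟ origin v w
  ... | yes _ = 1
  ... | no _  = m G (origin v u) (origin v w)
  σ′ : _ → _ → Sign
  σ′ u w with origin v u ≟ origin v w
  ... | yes _ = Sgn.+
  ... | no _  = σ G (origin v u) (origin v w)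

module Poly {c ℓ : Level} (R : CommutativeRing c ℓ) where
  open CommutativeRing R using (Carrier; _≈_; _+_; _*_; -_; 0#; 1#)

  data Expr (V : Set) : Set c where
    var : V → Expr V
    con : Carrier → Expr V
    _⊕_ : Expr V → Expr V → Expr V
    _⊗_ : Expr V → Expr V → Expr V
    ⊝_  : Expr V → Expr V

  infixl 6 _⊕_
  infixl 7 _⊗_
  infix 8 ⊝_

  -- Equality of polynomials: the congruence making Expr V the free
  -- commutative R-algebra on V, i.e. the polynomial ring R[V].
  infix 4 _≋_
  data _≋_ {V : Set} : Expr V → Expr V → Set (c ⊔ ℓ) where
    ≋-refl  : ∀ {p} → p ≋ p
    ≋-sym   : ∀ {p q} → p ≋ q → q ≋ p
    ≋-trans : ∀ {p q r} → p ≋ q → q ≋ r → p ≋ r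
    ⊕-cong  : ∀ {p p′ q q′} → p ≋ p′ → q ≋ q′ → p ⊕ q ≋ p′ ⊕ q′
    ⊗-cong  : ∀ {p p′ q q′} → p ≋ p′ → q ≋ q′ → p ⊗ q ≋ p′ ⊗ q′
    ⊝-cong  : ∀ {p q} → p ≋ q → ⊝ p ≋ ⊝ q
    con-cong : ∀ {a b} → a ≈ b → con a ≋ con b
    con-+   : ∀ a b → con (a + b) ≋ con a ⊕ con b
    con-*   : ∀ a b → con (a * b) ≋ con a ⊗ con b
    con-neg : ∀ a → con (- a) ≋ ⊝ con a
    ⊕-assoc : ∀ p q r → (p ⊕ q) ⊕ r ≋ p ⊕ (q ⊕ r)
    ⊕-comm  : ∀ p q → p ⊕ q ≋ q ⊕ p
    ⊕-idˡ   : ∀ p → con 0# ⊕ p ≋ p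
    ⊕-invˡ  : ∀ p → ⊝ p ⊕ p ≋ con 0#
    ⊗-assoc : ∀ p q r → (p ⊗ q) ⊗ r ≋ p ⊗ (q ⊗ r)
    ⊗-comm  : ∀ p q → p ⊗ q ≋ q ⊗ p
    ⊗-idˡ   : ∀ p → con 1# ⊗ p ≋ p
    ⊗-distribˡ-⊕ : ∀ p q r → p ⊗ (q ⊕ r) ≋ (p ⊗ q) ⊕ (p ⊗ r)

  bind : ∀ {V W : Set} → (V → Expr W) → Expr V → Expr W
  bind f (var x) = f x
  bind f (con a) = con a
  bind f (p ⊕ q) = bind f p ⊕ bind f q
  bind f (p ⊗ q) = bind f p ⊗ bind f q
  bind f (⊝ p)   = ⊝ bind f p

  data Gen {V : Set} {s : Level} (S : Expr V → Set s) : Expr V → Set (c ⊔ ℓ ⊔ s) where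
    gen  : ∀ {p} → S p → Gen S p
    gen-0 : Gen S (con 0#)
    add  : ∀ {p q} → Gen S p → Gen S q → Gen S (p ⊕ q)
    mul  : ∀ {p} (r : Expr V) → Gen S p → Gen S (r ⊗ p)
    resp : ∀ {p q} → p ≋ q → Gen S p → Gen S q

  Trivial : ∀ {V : Set} {s : Level} → (Expr V → Set s) → Set s
  Trivial I = I (con 1#)

  sumFin : ∀ {V : Set} k → (Fin k → Expr V) → Expr V
  sumFin zero    f = con 0#
  sumFin (suc k) f = f zero ⊕ sumFin k (λ j → f (suc j))

  altSign : ∀ {V : Set} {k} → Fin k → Expr V → Expr V
  altSign zero    e = e
  altSign (suc j) e = ⊝ altSign j e

  det : ∀ {V : Set} k → (Fin k → Fin k → Expr V) → Expr V
  det zero    M = con 1#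
  det (suc k) M = sumFin (suc k) (λ j →
    altSign j (M zero j ⊗ det k (λ a b → M (suc a) (punchIn j b))))

  StrictlyIncreasing : ∀ {i n} → (Fin i → Fin n) → Set
  StrictlyIncreasing f = ∀ a b → a F.< b → f a F.< f b

  IsMinor : ∀ {V : Set} {n} → (Fin n → Fin n → Expr V) → ℕ → Expr V → Set c
  IsMinor {n = n} M i p =
    Σ (Fin i → Fin n) λ rows → Σ (Fin i → Fin n) λ cols →
      StrictlyIncreasing rows × StrictlyIncreasing cols ×
      (p ≡ det i (λ a b → M (rows a) (cols b)))

  natR : ℕ → Carrier
  natR zero    = 0#
  natR (suc k) = 1# + natR k

  signR : Sign → Carrier → Carrier
  signR Sgn.+ a = a
  signR Sgn.- a = - a

  Laplacian : ∀ {n} → SignedMultidigraph n → Fin n → Fin n → Expr (Fin n)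
  Laplacian G u w with u ≟ w
  ... | yes _ = var u
  ... | no _  = ⊝ con (signR (σ G u w) (natR (m G u w)))

  CriticalIdeal : ∀ {n} → SignedMultidigraph n → ℕ → Expr (Fin n) → Set (c ⊔ ℓ)
  CriticalIdeal G i = Gen (IsMinor (Laplacian G) i)

  -- I|_{x_v = a}, regarded in the polynomial ring of r(G,v)
  -- (variables Fin (suc n), vertex u of G ↦ inject₁ u).
  evalAt : ∀ {n} → Fin n → Carrier → Fin n → Expr (Fin (suc n))
  evalAt v a u with u ≟ v
  ... | yes _ = con a
  ... | no _  = var (inject₁ u)

  Restrict : ∀ {n} {s : Level} → Fin n → Carrier → (Expr (Fin n) → Set s) →
             Expr (Fin (suc n)) → Set (c ⊔ ℓ ⊔ s)
  Restrict v a I = Gen (λ q → Σ _ λ p → I p × (q ≡ bind (evalAt v a) p))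

module _ {c ℓ : Level} (R : CommutativeRing c ℓ) where
  open CommutativeRing R

  record IsIdeal (I : Carrier → Set (c ⊔ ℓ)) : Set (c ⊔ ℓ) where
    field
      contains-0 : I 0#
      closed-+   : ∀ {x y} → I x → I y → I (x + y)
      closed-*   : ∀ r {x} → I x → I (r * x)
      respects-≈ : ∀ {x y} → x ≈ y → I x → I y

  record IsPID : Set (Level.suc (c ⊔ ℓ)) where
    field
      1≉0          : ¬ (1# ≈ 0#)
      no-zero-divisors : ∀ x y → x * y ≈ 0# → (x ≈ 0#) ⊎ (y ≈ 0#)
      principal    : ∀ I → IsIdeal I →
                     ∃ λ a → ∀ x → (I x → ∃ λ r → x ≈ r * a) × ((∃ λ r → x ≈ r * a) → I x)

module Submission where

-- Lemma 2.5 (replicating a vertex).  Write L for L(r(G,v),X) and K for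
-- L(G,X)|_{x_v = -1}, a matrix over the polynomials of r(G,v).
--
-- The substitution  collapse : x_v, x_{v¹} ↦ -1  turns L into K with the
-- row and column of v doubled, and it moves every polynomial only modulo
-- ⟨x_v + 1, x_{v¹} + 1⟩.  So each j-minor D of L is  D - collapse(D)  plus a
-- j×j determinant of K taken on possibly repeated rows and columns.  Such a
-- determinant lies in the ideal of j-minors of K: sorting its columns only
-- changes the sign, a repeated column makes it vanish, and transposition
-- reduces rows to columns.  Applying collapse to
-- it (collapse fixes 1 and restricted polynomials and kills x_v + 1 and
-- x_{v¹} + 1) shows that 1 ∈ I_j(r(G,v),X) forces 1 ∈ I_j(G,X)|_{x_v = -1}.
-- Conversely K is a submatrix of L (column v of K is column v¹ of L), so
-- I_j(G,X)|_{x_v = -1} ⊆ I_j(r(G,v),X).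

open import Defs
open import Level using (Level; _⊔_)
open import Function using (_∘_)
open import Function.Bundles using (_⇔_; mk⇔)
open import Data.Empty using (⊥-elim)
open import Data.Product using (_×_; _,_; Σ)
open import Data.Sum using (_⊎_; inj₁; inj₂)
open import Data.Nat using (ℕ; zero; suc; s≤s; z≤n; _≤_)
import Data.Nat as N
import Data.Nat.Properties as NP
open import Data.Fin using (Fin; zero; suc; toℕ; inject₁; fromℕ; punchIn)
import Data.Fin as F
import Data.Fin.Properties as FP
open import Relation.Nullary using (¬_; Dec; yes; no)
open import Relation.Binary.Definitions using (tri<; tri≈; tri>)
open import Relation.Binary.PropositionalEquality as P using (_≡_; refl)
open import Algebra.Bundles using (CommutativeRing)
import Algebra.Properties.Ring
import Algebra.Properties.CommutativeSemigroup

-- The transposition of the adjacent positions  inject₁ c  and  suc c.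
swapAdj : ∀ {k} → Fin (suc k) → Fin (suc (suc k)) → Fin (suc (suc k))
swapAdj zero zero = suc zero
swapAdj zero (suc zero) = zero
swapAdj zero (suc (suc x)) = suc (suc x)
swapAdj {suc k} (suc c) zero = zero
swapAdj {suc k} (suc c) (suc x) = suc (swapAdj c x)

swapAdj-lo : ∀ {k} (c : Fin (suc k)) → swapAdj c (inject₁ c) ≡ suc c
swapAdj-lo zero = refl
swapAdj-lo {suc k} (suc c) = P.cong suc (swapAdj-lo c)

swapAdj-hi : ∀ {k} (c : Fin (suc k)) → swapAdj c (suc c) ≡ inject₁ c
swapAdj-hi zero = refl
swapAdj-hi {suc k} (suc c) = P.cong suc (swapAdj-hi c)

swapAdj-punchIn-lo : ∀ {k} (c : Fin (suc k)) b → swapAdj c (punchIn (inject₁ c) b) ≡ punchIn (suc c) b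
swapAdj-punchIn-lo zero zero = refl
swapAdj-punchIn-lo zero (suc b) = refl
swapAdj-punchIn-lo {suc k} (suc c) zero = refl
swapAdj-punchIn-lo {suc k} (suc c) (suc b) = P.cong suc (swapAdj-punchIn-lo c b)

swapAdj-punchIn-hi : ∀ {k} (c : Fin (suc k)) b → swapAdj c (punchIn (suc c) b) ≡ punchIn (inject₁ c) b
swapAdj-punchIn-hi zero zero = refl
swapAdj-punchIn-hi zero (suc b) = refl
swapAdj-punchIn-hi {suc k} (suc c) zero = refl
swapAdj-punchIn-hi {suc k} (suc c) (suc b) = P.cong suc (swapAdj-punchIn-hi c b)

-- How a position j relates to the swap at c: it is one of the two swapped
-- positions, or it is fixed, and then deleting j turns the swap into an
-- adjacent swap at some c′ of the smaller index set.
data SwapView : ∀ {k} (c : Fin (suc k)) → Fin (suc (suc k)) → Set where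
  lo : ∀ {k} {c : Fin (suc k)} → SwapView c (inject₁ c)
  hi : ∀ {k} {c : Fin (suc k)} → SwapView c (suc c)
  away : ∀ {k} {c : Fin (suc (suc k))} {j : Fin (suc (suc (suc k)))} (c′ : Fin (suc k)) →
    swapAdj c j ≡ j →
    (∀ b → swapAdj c (punchIn j b) ≡ punchIn j (swapAdj c′ b)) →
    punchIn j (inject₁ c′) ≡ inject₁ c → punchIn j (suc c′) ≡ suc c →
    SwapView c j

swapView : ∀ {k} (c : Fin (suc k)) (j : Fin (suc (suc k))) → SwapView c j
swapView zero zero = lo
swapView zero (suc zero) = hi
swapView {suc k} zero (suc (suc j)) = away zero refl commute refl refl
  where
  commute : ∀ b → swapAdj zero (punchIn (suc (suc j)) b) ≡ punchIn (suc (suc j)) (swapAdj zero b)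
  commute zero = refl
  commute (suc zero) = refl
  commute (suc (suc b)) = refl
swapView {suc k} (suc c) zero = away c refl (λ b → refl) refl refl
swapView {suc k} (suc c) (suc j) with swapView c j
... | lo = lo
... | hi = hi
... | away c′ fixed commute lo′ hi′ =
  away (suc c′) (P.cong suc fixed) commute′ (P.cong suc lo′) (P.cong suc hi′)
  where
  commute′ : ∀ b → swapAdj (suc c) (punchIn (suc j) b) ≡ punchIn (suc j) (swapAdj (suc c′) b)
  commute′ zero = refl
  commute′ (suc b) = P.cong suc (commute b)

infixr 5 _∷ᶠ_
_∷ᶠ_ : ∀ {X : Set} {k} → X → (Fin k → X) → Fin (suc k) → X
(x ∷ᶠ g) zero = x
(x ∷ᶠ g) (suc i) = g i

data _∼_ {X : Set} : ∀ {k} → (Fin k → X) → (Fin k → X) → Set where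
  ∼-ext   : ∀ {k} {g g′ : Fin k → X} → (∀ i → g i ≡ g′ i) → g ∼ g′
  ∼-swap  : ∀ {k} {g g′ : Fin (suc (suc k)) → X} (c : Fin (suc k)) →
            (∀ i → g′ i ≡ g (swapAdj c i)) → g ∼ g′
  ∼-trans : ∀ {k} {g g′ g″ : Fin k → X} → g ∼ g′ → g′ ∼ g″ → g ∼ g″

∼-cons : ∀ {X : Set} {k} (x : X) {g g′ : Fin k → X} → g ∼ g′ → (x ∷ᶠ g) ∼ (x ∷ᶠ g′)
∼-cons x (∼-ext e) = ∼-ext λ { zero → refl ; (suc i) → e i }
∼-cons x (∼-swap c e) = ∼-swap (suc c) λ { zero → refl ; (suc i) → e i }
∼-cons x (∼-trans r r′) = ∼-trans (∼-cons x r) (∼-cons x r′)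

head∷tail : ∀ {X : Set} {k} (g : Fin (suc k) → X) → g ∼ (g zero ∷ᶠ (λ i → g (suc i)))
head∷tail g = ∼-ext λ { zero → refl ; (suc i) → refl }

swapHead : ∀ {X : Set} {k} (x : X) (s : Fin (suc k) → X) →
  (x ∷ᶠ s) ∼ (s zero ∷ᶠ x ∷ᶠ (λ i → s (suc i)))
swapHead x s = ∼-swap zero λ { zero → refl ; (suc zero) → refl ; (suc (suc i)) → refl }

∼-entries : ∀ {X : Set} {k} {g g′ : Fin k → X} → g ∼ g′ →
  ∀ b → Σ (Fin k) λ b′ → g′ b ≡ g b′
∼-entries (∼-ext e) b = b , P.sym (e b)
∼-entries (∼-swap c e) b = swapAdj c b , e b
∼-entries (∼-trans r r′) b with ∼-entries r′ b
... | b′ , e′ with ∼-entries r b′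
... | b″ , e″ = b″ , P.trans e′ e″

data HasRepeat {X : Set} : ∀ {k} → (Fin k → X) → Set where
  repeat : ∀ {k} {g g′ : Fin (suc (suc k)) → X} (c : Fin (suc k)) →
           g ∼ g′ → g′ (inject₁ c) ≡ g′ (suc c) → HasRepeat g

repeat-cons : ∀ {X : Set} {k} (x : X) {g : Fin k → X} → HasRepeat g → HasRepeat (x ∷ᶠ g)
repeat-cons x (repeat c r e) = repeat (suc c) (∼-cons x r) e

repeat-∼ : ∀ {X : Set} {k} {g g′ : Fin k → X} → g ∼ g′ → HasRepeat g′ → HasRepeat g
repeat-∼ r (repeat c r′ e) = repeat c (∼-trans r r′) e

Increasing : ∀ {m k} → (Fin k → Fin m) → Set
Increasing s = ∀ a b → a F.< b → s a F.< s b

increasing-cons : ∀ {m k} (x : Fin m) (s : Fin k → Fin m) →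
  Increasing s → (∀ b → x F.< s b) → Increasing (x ∷ᶠ s)
increasing-cons x s inc below zero zero ()
increasing-cons x s inc below zero (suc b) _ = below b
increasing-cons x s inc below (suc a) (suc b) (s≤s a<b) = inc a b a<b

Sorted : ∀ {m k} → (Fin k → Fin m) → Set
Sorted {m} {k} g = HasRepeat g ⊎ Σ (Fin k → Fin m) λ s → Increasing s × g ∼ s

insert : ∀ {m k} (x : Fin m) (s : Fin k → Fin m) → Increasing s → Sorted (x ∷ᶠ s)
insert {k = zero} x s _ = inj₂ (x ∷ᶠ s , (λ { zero zero () }) , ∼-ext λ _ → refl)
insert {k = suc k} x s inc with FP.<-cmp x (s zero)
... | tri< x<s₀ _ _ = inj₂ (x ∷ᶠ s , increasing-cons x s inc below , ∼-ext λ _ → refl)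
  where
  below : ∀ b → x F.< s b
  below zero = x<s₀
  below (suc b) = FP.<-trans x<s₀ (inc zero (suc b) (s≤s z≤n))
... | tri≈ _ x≡s₀ _ = inj₁ (repeat zero (∼-ext λ _ → refl) x≡s₀)
... | tri> _ _ s₀<x with insert x (λ i → s (suc i)) (λ a b a<b → inc (suc a) (suc b) (s≤s a<b))
...   | inj₁ rep = inj₁ (repeat-∼ (swapHead x s) (repeat-cons (s zero) rep))
...   | inj₂ (s′ , inc′ , r′) =
  inj₂ (s zero ∷ᶠ s′ , increasing-cons (s zero) s′ inc′ below ,
        ∼-trans (swapHead x s) (∼-cons (s zero) r′))
  where
  below : ∀ b → s zero F.< s′ b
  below b with ∼-entries r′ b
  ... | zero , e = P.subst (s zero F.<_) (P.sym e) s₀<x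
  ... | suc b′ , e = P.subst (s zero F.<_) (P.sym e) (inc zero (suc b′) (s≤s z≤n))

sort : ∀ {m} k (g : Fin k → Fin m) → Sorted g
sort zero g = inj₂ (g , (λ ()) , ∼-ext λ _ → refl)
sort (suc k) g with sort k (λ i → g (suc i))
... | inj₁ rep = inj₁ (repeat-∼ (head∷tail g) (repeat-cons (g zero) rep))
... | inj₂ (s , inc , r) with insert (g zero) s inc
...   | inj₁ rep = inj₁ (repeat-∼ (∼-trans (head∷tail g) (∼-cons (g zero) r)) rep)
...   | inj₂ (s′ , inc′ , r′) =
  inj₂ (s′ , inc′ , ∼-trans (head∷tail g) (∼-trans (∼-cons (g zero) r) r′))

module Replication {c ℓ : Level} (R : CommutativeRing c ℓ) where
  open CommutativeRing R using (Carrier; _+_; -_; 0#; 1#)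
  open Poly R

  polyRing : (V : Set) → CommutativeRing c (c ⊔ ℓ)
  polyRing V = record
    { Carrier = Expr V ; _≈_ = _≋_ ; _+_ = _⊕_ ; _*_ = _⊗_ ; -_ = ⊝_ ; 0# = con 0# ; 1# = con 1#
    ; isCommutativeRing = record
      { isRing = record
        { +-isAbelianGroup = record
          { isGroup = record
            { isMonoid = record
              { isSemigroup = record
                { isMagma = record
                  { isEquivalence = record { refl = ≋-refl ; sym = ≋-sym ; trans = ≋-trans }
                  ; ∙-cong = ⊕-cong }
                ; assoc = ⊕-assoc }
              ; identity = ⊕-idˡ , λ p → ≋-trans (⊕-comm p (con 0#)) (⊕-idˡ p) }
            ; inverse = ⊕-invˡ , λ p → ≋-trans (⊕-comm p (⊝ p)) (⊕-invˡ p)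
            ; ⁻¹-cong = ⊝-cong }
          ; comm = ⊕-comm }
        ; *-cong = ⊗-cong
        ; *-assoc = ⊗-assoc
        ; *-identity = ⊗-idˡ , λ p → ≋-trans (⊗-comm p (con 1#)) (⊗-idˡ p)
        ; distrib = ⊗-distribˡ-⊕ , λ p q r → ≋-trans (⊗-comm (q ⊕ r) p)
               (≋-trans (⊗-distribˡ-⊕ p q r) (⊕-cong (⊗-comm p q) (⊗-comm p r))) }
      ; *-comm = ⊗-comm } }

  ≡⇒≋ : ∀ {V : Set} {p q : Expr V} → p ≡ q → p ≋ q
  ≡⇒≋ refl = ≋-refl


  module _ {V : Set} where
    open CommutativeRing (polyRing V) using (zeroʳ)
    open Algebra.Properties.Ring (CommutativeRing.ring (polyRing V))
      using (-0#≈0#; -‿+-comm; -‿distribʳ-*)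
    open Algebra.Properties.CommutativeSemigroup (CommutativeRing.+-commutativeSemigroup (polyRing V))
      using (interchange)

    private
      E = Expr V

    sum-cong : ∀ k {f g : Fin k → E} → (∀ i → f i ≋ g i) → sumFin k f ≋ sumFin k g
    sum-cong zero eq = ≋-refl
    sum-cong (suc k) eq = ⊕-cong (eq zero) (sum-cong k (λ i → eq (suc i)))

    sum-0 : ∀ k → sumFin k (λ _ → con 0#) ≋ con {V} 0#
    sum-0 zero = ≋-refl
    sum-0 (suc k) = ≋-trans (⊕-idˡ _) (sum-0 k)

    sum-⊕ : ∀ k (f g : Fin k → E) → sumFin k f ⊕ sumFin k g ≋ sumFin k (λ i → f i ⊕ g i)
    sum-⊕ zero f g = ⊕-idˡ _
    sum-⊕ (suc k) f g =
      ≋-trans (interchange (f zero) (sumFin k (λ i → f (suc i))) (g zero) (sumFin k (λ i → g (suc i))))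
              (⊕-cong ≋-refl (sum-⊕ k _ _))

    sum-⊗ : ∀ k (a : E) (f : Fin k → E) → a ⊗ sumFin k f ≋ sumFin k (λ i → a ⊗ f i)
    sum-⊗ zero a f = zeroʳ a
    sum-⊗ (suc k) a f = ≋-trans (⊗-distribˡ-⊕ _ _ _) (⊕-cong ≋-refl (sum-⊗ k a _))

    sum-⊝ : ∀ k (f : Fin k → E) → ⊝ sumFin k f ≋ sumFin k (λ i → ⊝ f i)
    sum-⊝ zero f = -0#≈0#
    sum-⊝ (suc k) f = ≋-trans (≋-sym (-‿+-comm _ _)) (⊕-cong ≋-refl (sum-⊝ k _))

    sum-swap : ∀ k l (F : Fin k → Fin l → E) →
      sumFin k (λ i → sumFin l (F i)) ≋ sumFin l (λ j → sumFin k (λ i → F i j))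
    sum-swap zero l F = ≋-sym (sum-0 l)
    sum-swap (suc k) l F = ≋-trans (⊕-cong ≋-refl (sum-swap k l (λ i → F (suc i)))) (sum-⊕ l _ _)

    alt-cong : ∀ {k} (j : Fin k) {p q : E} → p ≋ q → altSign j p ≋ altSign j q
    alt-cong zero eq = eq
    alt-cong (suc j) eq = ⊝-cong (alt-cong j eq)

    alt-⊝ : ∀ {k} (j : Fin k) (p : E) → altSign j (⊝ p) ≋ ⊝ altSign j p
    alt-⊝ zero p = ≋-refl
    alt-⊝ (suc j) p = ⊝-cong (alt-⊝ j p)

    alt-⊗ : ∀ {k} (j : Fin k) (a p : E) → altSign j (a ⊗ p) ≋ a ⊗ altSign j p
    alt-⊗ zero a p = ≋-refl
    alt-⊗ (suc j) a p = ≋-trans (⊝-cong (alt-⊗ j a p)) (-‿distribʳ-* a _)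

    alt-sum : ∀ {k} (j : Fin k) l (f : Fin l → E) →
      altSign j (sumFin l f) ≋ sumFin l (λ i → altSign j (f i))
    alt-sum zero l f = ≋-refl
    alt-sum (suc j) l f = ≋-trans (⊝-cong (alt-sum j l f)) (sum-⊝ l _)

    alt-comm : ∀ {k l} (i : Fin k) (j : Fin l) (p : E) → altSign i (altSign j p) ≋ altSign j (altSign i p)
    alt-comm i zero p = ≋-refl
    alt-comm i (suc j) p = ≋-trans (alt-⊝ i _) (⊝-cong (alt-comm i j p))

    alt-0 : ∀ {k} (j : Fin k) → altSign j (con 0#) ≋ con {V} 0#
    alt-0 zero = ≋-refl
    alt-0 (suc j) = ≋-trans (⊝-cong (alt-0 j)) -0#≈0#

    alt-inject₁ : ∀ {k} (j : Fin k) (p : E) → altSign (inject₁ j) p ≡ altSign j p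
    alt-inject₁ zero p = refl
    alt-inject₁ (suc j) p = P.cong ⊝_ (alt-inject₁ j p)

  module _ {V : Set} where
    open CommutativeRing (polyRing V) using (zeroʳ; -‿inverseʳ) renaming (setoid to polySetoid)
    open Algebra.Properties.Ring (CommutativeRing.ring (polyRing V))
      using (-‿involutive; -0#≈0#; -‿distribʳ-*)
    open Algebra.Properties.CommutativeSemigroup (CommutativeRing.*-commutativeSemigroup (polyRing V))
      using () renaming (x∙yz≈y∙xz to ⊗-left-commute)
    open import Relation.Binary.Reasoning.Setoid polySetoid

    private
      E = Expr V

    rowTerm : ∀ k (M : Fin (suc k) → Fin (suc k) → E) → Fin (suc k) → E
    rowTerm k M j = altSign j (M zero j ⊗ det k (λ a b → M (suc a) (punchIn j b)))

    det-cong : ∀ k {M N : Fin k → Fin k → E} → (∀ a b → M a b ≋ N a b) → det k M ≋ det k N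
    det-cong zero eq = ≋-refl
    det-cong (suc k) eq = sum-cong (suc k) λ j →
      alt-cong j (⊗-cong (eq zero j) (det-cong k (λ a b → eq (suc a) (punchIn j b))))

    columnExpansion : ∀ k → (Fin (suc k) → Fin (suc k) → E) → E
    columnExpansion k M = sumFin (suc k) λ i →
      altSign i (M i zero ⊗ det k (λ a b → M (punchIn i a) (suc b)))

    -- Both expansions of a determinant with first row x and first column y
    -- are the double sum  Σ_i Σ_j ± x_j y_i B_ij  over the complementary
    -- (k-1)×(k-1) minors B_ij; this is that sum written with the j-sum outside.
    doubleExpansion : ∀ k l (x : Fin k → E) (y : Fin l → E) (B : Fin l → Fin k → E) →
      sumFin k (λ j → ⊝ altSign j (x j ⊗ sumFin l (λ i → altSign i (y i ⊗ B i j))))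
        ≋ sumFin k (λ j → sumFin l (λ i → ⊝ altSign j (altSign i (x j ⊗ (y i ⊗ B i j)))))
    doubleExpansion k l x y B = sum-cong k λ j → begin
      ⊝ altSign j (x j ⊗ sumFin l (λ i → altSign i (y i ⊗ B i j)))
        ≈⟨ ⊝-cong (alt-cong j (sum-⊗ l (x j) _)) ⟩
      ⊝ altSign j (sumFin l (λ i → x j ⊗ altSign i (y i ⊗ B i j)))
        ≈⟨ ⊝-cong (alt-sum j l _) ⟩
      ⊝ sumFin l (λ i → altSign j (x j ⊗ altSign i (y i ⊗ B i j)))
        ≈⟨ sum-⊝ l _ ⟩
      sumFin l (λ i → ⊝ altSign j (x j ⊗ altSign i (y i ⊗ B i j)))
        ≈⟨ sum-cong l (λ i → ⊝-cong (alt-cong j (≋-sym (alt-⊗ i (x j) _)))) ⟩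
      sumFin l (λ i → ⊝ altSign j (altSign i (x j ⊗ (y i ⊗ B i j)))) ∎

    det≋columnExpansion : ∀ k (M : Fin (suc k) → Fin (suc k) → E) → det (suc k) M ≋ columnExpansion k M
    det≋columnExpansion zero M = ≋-refl
    det≋columnExpansion (suc k) M = ⊕-cong ≋-refl (begin
      sumFin (suc k) (λ j → ⊝ altSign j (x j ⊗ det (suc k) (λ a b → M (suc a) (punchIn (suc j) b))))
        ≈⟨ sum-cong (suc k) (λ j → ⊝-cong (alt-cong j (⊗-cong (≋-refl {p = x j})
             (det≋columnExpansion k (λ a b → M (suc a) (punchIn (suc j) b)))))) ⟩
      sumFin (suc k) (λ j → ⊝ altSign j (x j ⊗ sumFin (suc k) (λ i → altSign i (y i ⊗ B i j))))
        ≈⟨ doubleExpansion (suc k) (suc k) x y B ⟩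
      sumFin (suc k) (λ j → sumFin (suc k) (λ i → ⊝ altSign j (altSign i (x j ⊗ (y i ⊗ B i j)))))
        ≈⟨ sum-swap (suc k) (suc k) (λ j i → ⊝ altSign j (altSign i (x j ⊗ (y i ⊗ B i j)))) ⟩
      sumFin (suc k) (λ i → sumFin (suc k) (λ j → ⊝ altSign j (altSign i (x j ⊗ (y i ⊗ B i j)))))
        ≈⟨ sum-cong (suc k) (λ i → sum-cong (suc k) (λ j → ⊝-cong
             (≋-trans (alt-comm j i _) (alt-cong i (alt-cong j (⊗-left-commute (x j) (y i) (B i j))))))) ⟩
      sumFin (suc k) (λ i → sumFin (suc k) (λ j → ⊝ altSign i (altSign j (y i ⊗ (x j ⊗ B i j)))))
        ≈⟨ ≋-sym (doubleExpansion (suc k) (suc k) y x (λ j i → B i j)) ⟩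
      sumFin (suc k) (λ i → ⊝ altSign i (y i ⊗ det (suc k) (λ a b → M (punchIn (suc i) a) (suc b)))) ∎)
      where
      x y : Fin (suc k) → E
      x j = M zero (suc j)
      y i = M (suc i) zero
      B : Fin (suc k) → Fin (suc k) → E
      B i j = det k (λ a b → M (suc (punchIn i a)) (suc (punchIn j b)))

    det-transpose : ∀ k (M : Fin k → Fin k → E) → det k M ≋ det k (λ a b → M b a)
    det-transpose zero M = ≋-refl
    det-transpose (suc k) M = ≋-trans (det≋columnExpansion k M) (sum-cong (suc k) λ i →
      alt-cong i (⊗-cong (≋-refl {p = M i zero}) (det-transpose k (λ a b → M (punchIn i a) (suc b)))))

    sum-swapAdj : ∀ k (c : Fin (suc k)) (f : Fin (suc (suc k)) → E) →
      sumFin (suc (suc k)) (λ j → f (swapAdj c j)) ≋ sumFin (suc (suc k)) f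
    sum-swapAdj k zero f =
      ≋-trans (≋-sym (⊕-assoc _ _ _)) (≋-trans (⊕-cong (⊕-comm _ _) ≋-refl) (⊕-assoc _ _ _))
    sum-swapAdj (suc k) (suc c) f = ⊕-cong ≋-refl (sum-swapAdj k c (λ j → f (suc j)))

    -- In the first-row expansion, the terms of the swapped columns trade
    -- places with opposite signs; every other term is handled by induction.
    det-swapAdj : ∀ k (M : Fin (suc (suc k)) → Fin (suc (suc k)) → E) (c : Fin (suc k)) →
      det (suc (suc k)) (λ a b → M a (swapAdj c b)) ≋ ⊝ det (suc (suc k)) M
    det-swapAdj k M c = begin
      sumFin (suc (suc k)) term′                       ≈⟨ ≋-sym (sum-swapAdj k c term′) ⟩
      sumFin (suc (suc k)) (λ j → term′ (swapAdj c j)) ≈⟨ sum-cong (suc (suc k)) termSwapped ⟩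
      sumFin (suc (suc k)) (λ j → ⊝ term j)            ≈⟨ ≋-sym (sum-⊝ (suc (suc k)) term) ⟩
      ⊝ sumFin (suc (suc k)) term                      ∎
      where
      term term′ : Fin (suc (suc k)) → E
      term = rowTerm (suc k) M
      term′ = rowTerm (suc k) (λ a b → M a (swapAdj c b))
      termSwapped : ∀ j → term′ (swapAdj c j) ≋ ⊝ term j
      termSwapped j with swapView c j
      ... | lo = ≋-trans (≡⇒≋ (P.cong term′ (swapAdj-lo c)))
            (⊝-cong (≋-trans (alt-cong c (⊗-cong (≡⇒≋ (P.cong (M zero) (swapAdj-hi c)))
               (det-cong (suc k) (λ a b → ≡⇒≋ (P.cong (M (suc a)) (swapAdj-punchIn-hi c b))))))
              (≡⇒≋ (P.sym (alt-inject₁ c _)))))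
      ... | hi = ≋-trans (≡⇒≋ (P.cong term′ (swapAdj-hi c)))
            (≋-trans (≡⇒≋ (alt-inject₁ c _))
            (≋-trans (alt-cong c (⊗-cong (≡⇒≋ (P.cong (M zero) (swapAdj-lo c)))
               (det-cong (suc k) (λ a b → ≡⇒≋ (P.cong (M (suc a)) (swapAdj-punchIn-lo c b))))))
              (≋-sym (-‿involutive _))))
      ... | away {k = k′} c′ fixed commute _ _ = ≋-trans (≡⇒≋ (P.cong term′ fixed))
            (≋-trans (alt-cong j (⊗-cong (≡⇒≋ (P.cong (M zero) fixed))
              (≋-trans (det-cong (suc k) (λ a b → ≡⇒≋ (P.cong (M (suc a)) (commute b))))
                (det-swapAdj k′ (λ a b → M (suc a) (punchIn j b)) c′))))
            (≋-trans (alt-cong j (≋-sym (-‿distribʳ-* _ _))) (alt-⊝ j _)))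

    sum-cancellingPair : ∀ k (c : Fin (suc k)) (f : Fin (suc (suc k)) → E) →
      f (suc c) ≋ ⊝ f (inject₁ c) →
      (∀ j → ¬ (j ≡ inject₁ c) → ¬ (j ≡ suc c) → f j ≋ con 0#) →
      sumFin (suc (suc k)) f ≋ con 0#
    sum-cancellingPair k zero f cancel others = ≋-trans (≋-sym (⊕-assoc _ _ _))
      (≋-trans (⊕-cong (≋-trans (⊕-cong ≋-refl cancel) (-‿inverseʳ _))
                       (≋-trans (sum-cong k (λ j → others (suc (suc j)) (λ ()) (λ ()))) (sum-0 k)))
        (⊕-idˡ _))
    sum-cancellingPair (suc k) (suc c) f cancel others = ≋-trans (⊕-cong (others zero (λ ()) (λ ())) ≋-refl)
      (≋-trans (⊕-idˡ _) (sum-cancellingPair k c (λ j → f (suc j)) cancel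
        (λ j j≢lo j≢hi → others (suc j) (j≢lo ∘ FP.suc-injective) (j≢hi ∘ FP.suc-injective))))

    row-swapAdj : ∀ {k} (row : Fin (suc (suc k)) → E) (c : Fin (suc k)) →
      row (inject₁ c) ≋ row (suc c) → ∀ b → row (swapAdj c b) ≋ row b
    row-swapAdj row c same b with swapView c b
    ... | lo = ≋-trans (≡⇒≋ (P.cong row (swapAdj-lo c))) (≋-sym same)
    ... | hi = ≋-trans (≡⇒≋ (P.cong row (swapAdj-hi c))) same
    ... | away _ fixed _ _ _ = ≡⇒≋ (P.cong row fixed)

    -- A determinant with two equal adjacent columns vanishes (over any
    -- commutative ring, so this does not follow from det-swapAdj).
    det-equalAdjCols : ∀ k (M : Fin (suc (suc k)) → Fin (suc (suc k)) → E) (c : Fin (suc k)) →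
      (∀ a → M a (inject₁ c) ≋ M a (suc c)) → det (suc (suc k)) M ≋ con 0#
    det-equalAdjCols k M c same = sum-cancellingPair k c term cancel others
      where
      term : Fin (suc (suc k)) → E
      term = rowTerm (suc k) M
      cancel : term (suc c) ≋ ⊝ term (inject₁ c)
      cancel = ⊝-cong (≋-trans (alt-cong c (⊗-cong (≋-sym (same zero))
        (det-cong (suc k) λ a b →
          ≋-trans (≋-sym (row-swapAdj (M (suc a)) c (same (suc a)) (punchIn (suc c) b)))
                  (≡⇒≋ (P.cong (M (suc a)) (swapAdj-punchIn-hi c b))))))
        (≡⇒≋ (P.sym (alt-inject₁ c _))))
      others : ∀ j → ¬ (j ≡ inject₁ c) → ¬ (j ≡ suc c) → term j ≋ con 0#
      others j j≢lo j≢hi with swapView c j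
      ... | lo = ⊥-elim (j≢lo refl)
      ... | hi = ⊥-elim (j≢hi refl)
      ... | away {k = k′} c′ _ _ lo′ hi′ = ≋-trans (alt-cong j (≋-trans (⊗-cong (≋-refl {p = M zero j})
              (det-equalAdjCols k′ (λ a b → M (suc a) (punchIn j b)) c′ λ a →
                 ≋-trans (≡⇒≋ (P.cong (M (suc a)) lo′))
                         (≋-trans (same (suc a)) (≡⇒≋ (P.cong (M (suc a)) (P.sym hi′))))))
              (zeroʳ _))) (alt-0 j)

    _≋±_ : E → E → Set (c ⊔ ℓ)
    a ≋± b = (a ≋ b) ⊎ (a ≋ ⊝ b)

    ≋±-trans : ∀ {a b d : E} → a ≋± b → b ≋± d → a ≋± d
    ≋±-trans (inj₁ x) (inj₁ y) = inj₁ (≋-trans x y)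
    ≋±-trans (inj₁ x) (inj₂ y) = inj₂ (≋-trans x y)
    ≋±-trans (inj₂ x) (inj₁ y) = inj₂ (≋-trans x (⊝-cong y))
    ≋±-trans (inj₂ x) (inj₂ y) = inj₁ (≋-trans x (≋-trans (⊝-cong y) (-‿involutive _)))

    ≋±-vanish : ∀ {a b : E} → a ≋± b → b ≋ con 0# → a ≋ con 0#
    ≋±-vanish (inj₁ x) b≋0 = ≋-trans x b≋0
    ≋±-vanish (inj₂ x) b≋0 = ≋-trans x (≋-trans (⊝-cong b≋0) -0#≈0#)

    det-rearrange : ∀ {X : Set} {k} (C : Fin k → X → E) {g g′ : Fin k → X} → g ∼ g′ →
      det k (λ a b → C a (g b)) ≋± det k (λ a b → C a (g′ b))
    det-rearrange {k = k} C (∼-ext e) = inj₁ (det-cong k λ a b → ≡⇒≋ (P.cong (C a) (e b)))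
    det-rearrange {k = suc (suc k)} C {g} {g′} (∼-swap c e) = inj₂ (begin
      det (suc (suc k)) (λ a b → C a (g b))
        ≈⟨ ≋-sym (-‿involutive _) ⟩
      ⊝ ⊝ det (suc (suc k)) (λ a b → C a (g b))
        ≈⟨ ⊝-cong (≋-sym (det-swapAdj k (λ a b → C a (g b)) c)) ⟩
      ⊝ det (suc (suc k)) (λ a b → C a (g (swapAdj c b)))
        ≈⟨ ⊝-cong (det-cong (suc (suc k)) λ a b → ≡⇒≋ (P.cong (C a) (P.sym (e b)))) ⟩
      ⊝ det (suc (suc k)) (λ a b → C a (g′ b)) ∎)
    det-rearrange C (∼-trans r r′) = ≋±-trans (det-rearrange C r) (det-rearrange C r′)

    det-repeat : ∀ {X : Set} {k} (C : Fin k → X → E) {g : Fin k → X} → HasRepeat g →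
      det k (λ a b → C a (g b)) ≋ con 0#
    det-repeat {k = suc (suc k)} C (repeat {g′ = g′} c r same) =
      ≋±-vanish (det-rearrange C r)
        (det-equalAdjCols k (λ a b → C a (g′ b)) c (λ a → ≡⇒≋ (P.cong (C a) same)))

  module _ {V : Set} where
    open Algebra.Properties.Ring (CommutativeRing.ring (polyRing V)) using (-‿distribˡ-*)

    private
      E = Expr V

    Gen-mono : ∀ {s s′} {S : E → Set s} {S′ : E → Set s′} →
      (∀ p → S p → Gen S′ p) → ∀ {p} → Gen S p → Gen S′ p
    Gen-mono h (gen x) = h _ x
    Gen-mono h gen-0 = gen-0
    Gen-mono h (add g g′) = add (Gen-mono h g) (Gen-mono h g′)
    Gen-mono h (mul r g) = mul r (Gen-mono h g)
    Gen-mono h (resp e g) = resp e (Gen-mono h g)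

    Gen-⊝ : ∀ {s} {S : E → Set s} {b : E} → Gen S b → Gen S (⊝ b)
    Gen-⊝ g = resp (≋-trans (⊗-cong (con-neg 1#) ≋-refl)
                   (≋-trans (≋-sym (-‿distribˡ-* _ _)) (⊝-cong (⊗-idˡ _))))
                   (mul (con (- 1#)) g)

    Gen-≋± : ∀ {s} {S : E → Set s} {a b : E} → a ≋± b → Gen S b → Gen S a
    Gen-≋± (inj₁ e) g = resp (≋-sym e) g
    Gen-≋± (inj₂ e) g = resp (≋-sym e) (Gen-⊝ g)

    -- Every j×j determinant built from arbitrary (possibly repeated or
    -- unordered) rows f and columns g of M lies in the ideal of j-minors
    -- of M: sort the columns, transpose, sort the rows.
    det-inMinorIdeal : ∀ {m} (M : Fin m → Fin m → E) j (f g : Fin j → Fin m) →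
      Gen (IsMinor M j) (det j (λ a b → M (f a) (g b)))
    det-inMinorIdeal M j f g with sort j g
    ... | inj₁ rep = resp (≋-sym (det-repeat (λ a x → M (f a) x) rep)) gen-0
    ... | inj₂ (g′ , g′-inc , g∼g′) =
      Gen-≋± (det-rearrange (λ a x → M (f a) x) g∼g′)
        (resp (≋-sym (det-transpose j (λ a b → M (f a) (g′ b)))) transposed)
      where
      transposed : Gen (IsMinor M j) (det j (λ a b → M (f b) (g′ a)))
      transposed with sort j f
      ... | inj₁ rep = resp (≋-sym (det-repeat (λ a x → M x (g′ a)) rep)) gen-0
      ... | inj₂ (f′ , f′-inc , f∼f′) = Gen-≋± (det-rearrange (λ a x → M x (g′ a)) f∼f′)
        (resp (det-transpose j (λ a b → M (f′ a) (g′ b))) (gen (f′ , g′ , f′-inc , g′-inc , refl)))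

  module _ {V W : Set} (f : V → Expr W) where
    bind-cong : ∀ {p q} → p ≋ q → bind f p ≋ bind f q
    bind-cong ≋-refl = ≋-refl
    bind-cong (≋-sym e) = ≋-sym (bind-cong e)
    bind-cong (≋-trans e e′) = ≋-trans (bind-cong e) (bind-cong e′)
    bind-cong (⊕-cong e e′) = ⊕-cong (bind-cong e) (bind-cong e′)
    bind-cong (⊗-cong e e′) = ⊗-cong (bind-cong e) (bind-cong e′)
    bind-cong (⊝-cong e) = ⊝-cong (bind-cong e)
    bind-cong (con-cong x) = con-cong x
    bind-cong (con-+ a b) = con-+ a b
    bind-cong (con-* a b) = con-* a b
    bind-cong (con-neg a) = con-neg a
    bind-cong (⊕-assoc p q r) = ⊕-assoc _ _ _
    bind-cong (⊕-comm p q) = ⊕-comm _ _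
    bind-cong (⊕-idˡ p) = ⊕-idˡ _
    bind-cong (⊕-invˡ p) = ⊕-invˡ _
    bind-cong (⊗-assoc p q r) = ⊗-assoc _ _ _
    bind-cong (⊗-comm p q) = ⊗-comm _ _
    bind-cong (⊗-idˡ p) = ⊗-idˡ _
    bind-cong (⊗-distribˡ-⊕ p q r) = ⊗-distribˡ-⊕ _ _ _

    bind-alt : ∀ {k} (j : Fin k) p → bind f (altSign j p) ≡ altSign j (bind f p)
    bind-alt zero p = refl
    bind-alt (suc j) p = P.cong ⊝_ (bind-alt j p)

    bind-sum : ∀ k (g : Fin k → Expr V) → bind f (sumFin k g) ≋ sumFin k (λ i → bind f (g i))
    bind-sum zero g = ≋-refl
    bind-sum (suc k) g = ⊕-cong ≋-refl (bind-sum k _)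

    bind-det : ∀ k (M : Fin k → Fin k → Expr V) → bind f (det k M) ≋ det k (λ a b → bind f (M a b))
    bind-det zero M = ≋-refl
    bind-det (suc k) M = ≋-trans (bind-sum (suc k) (rowTerm k M)) (sum-cong (suc k) λ j →
      ≋-trans (≡⇒≋ (bind-alt j (M zero j ⊗ det k (λ a b → M (suc a) (punchIn j b)))))
        (alt-cong j (⊗-cong (≋-refl {p = bind f (M zero j)}) (bind-det k (λ a b → M (suc a) (punchIn j b))))))

    Gen-bind : ∀ {s s′} {S : Expr V → Set s} {S′ : Expr W → Set s′} →
      (∀ p → S p → Gen S′ (bind f p)) → ∀ {p} → Gen S p → Gen S′ (bind f p)
    Gen-bind h (gen x) = h _ x
    Gen-bind h gen-0 = gen-0
    Gen-bind h (add g g′) = add (Gen-bind h g) (Gen-bind h g′)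
    Gen-bind h (mul r g) = mul (bind f r) (Gen-bind h g)
    Gen-bind h (resp e g) = resp (bind-cong e) (Gen-bind h g)

  bind-bind : ∀ {U V W : Set} (f : V → Expr W) (g : U → Expr V) p →
    bind f (bind g p) ≡ bind (λ x → bind f (g x)) p
  bind-bind f g (var x) = refl
  bind-bind f g (con a) = refl
  bind-bind f g (p ⊕ q) = P.cong₂ _⊕_ (bind-bind f g p) (bind-bind f g q)
  bind-bind f g (p ⊗ q) = P.cong₂ _⊗_ (bind-bind f g p) (bind-bind f g q)
  bind-bind f g (⊝ p) = P.cong ⊝_ (bind-bind f g p)

  bind-ext : ∀ {V W : Set} {f g : V → Expr W} → (∀ x → f x ≋ g x) → ∀ p → bind f p ≋ bind g p
  bind-ext h (var x) = h x
  bind-ext h (con a) = ≋-refl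
  bind-ext h (p ⊕ q) = ⊕-cong (bind-ext h p) (bind-ext h q)
  bind-ext h (p ⊗ q) = ⊗-cong (bind-ext h p) (bind-ext h q)
  bind-ext h (⊝ p) = ⊝-cong (bind-ext h p)

  module _ {V : Set} {s} {S : Expr V → Set s} (φ : V → Expr V) where
    open CommutativeRing (polyRing V) using (-‿inverseʳ; +-identityʳ) renaming (setoid to polySetoid)
    open Algebra.Properties.Ring (CommutativeRing.ring (polyRing V)) using (-‿+-comm; -‿distribʳ-*)
    open Algebra.Properties.CommutativeSemigroup (CommutativeRing.+-commutativeSemigroup (polyRing V))
      using (interchange)
    open import Relation.Binary.Reasoning.Setoid polySetoid

    private
      E = Expr V

    -- The identities expressing  p∘q - φ(p)∘φ(q)  through  p - φ(p)  and
    -- q - φ(q)  for  ∘ = ⊕, ⊗, and  ⊝p - ⊝φ(p)  through  p - φ(p).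
    sum-of-differences : ∀ (p q a b : E) → (p ⊕ ⊝ a) ⊕ (q ⊕ ⊝ b) ≋ (p ⊕ q) ⊕ ⊝ (a ⊕ b)
    sum-of-differences p q a b = begin
      (p ⊕ ⊝ a) ⊕ (q ⊕ ⊝ b)   ≈⟨ interchange p (⊝ a) q (⊝ b) ⟩
      (p ⊕ q) ⊕ (⊝ a ⊕ ⊝ b)   ≈⟨ ⊕-cong ≋-refl (-‿+-comm a b) ⟩
      (p ⊕ q) ⊕ ⊝ (a ⊕ b)     ∎

    product-of-differences : ∀ (p q a b : E) →
      p ⊗ (q ⊕ ⊝ b) ⊕ b ⊗ (p ⊕ ⊝ a) ≋ p ⊗ q ⊕ ⊝ (a ⊗ b)
    product-of-differences p q a b = begin
      p ⊗ (q ⊕ ⊝ b) ⊕ b ⊗ (p ⊕ ⊝ a)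
        ≈⟨ ⊕-cong (distribute p q b)
                  (≋-trans (distribute b p a) (⊕-cong (⊗-comm b p) (⊝-cong (⊗-comm b a)))) ⟩
      (p ⊗ q ⊕ ⊝ (p ⊗ b)) ⊕ (p ⊗ b ⊕ ⊝ (a ⊗ b))
        ≈⟨ regroup (p ⊗ q) (⊝ (p ⊗ b)) (p ⊗ b) (⊝ (a ⊗ b)) ⟩
      p ⊗ q ⊕ ((⊝ (p ⊗ b) ⊕ p ⊗ b) ⊕ ⊝ (a ⊗ b))
        ≈⟨ ⊕-cong ≋-refl (≋-trans (⊕-cong (⊕-invˡ _) ≋-refl) (⊕-idˡ _)) ⟩
      p ⊗ q ⊕ ⊝ (a ⊗ b) ∎
      where
      distribute : ∀ (x y z : E) → x ⊗ (y ⊕ ⊝ z) ≋ x ⊗ y ⊕ ⊝ (x ⊗ z)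
      distribute x y z = ≋-trans (⊗-distribˡ-⊕ x y (⊝ z)) (⊕-cong ≋-refl (≋-sym (-‿distribʳ-* x z)))
      regroup : ∀ (x y z w : E) → (x ⊕ y) ⊕ (z ⊕ w) ≋ x ⊕ ((y ⊕ z) ⊕ w)
      regroup x y z w = ≋-trans (⊕-assoc x y (z ⊕ w)) (⊕-cong ≋-refl (≋-sym (⊕-assoc y z w)))

    negated-difference : ∀ (p a : E) → ⊝ (p ⊕ ⊝ a) ≋ ⊝ p ⊕ ⊝ ⊝ a
    negated-difference p a = ≋-sym (-‿+-comm p (⊝ a))

    Gen-difference : (∀ x → Gen S (var x ⊕ ⊝ φ x)) → ∀ e → Gen S (e ⊕ ⊝ bind φ e)
    Gen-difference onVars (var x) = onVars x
    Gen-difference onVars (con a) = resp (≋-sym (-‿inverseʳ _)) gen-0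
    Gen-difference onVars (p ⊕ q) = resp (sum-of-differences p q (bind φ p) (bind φ q))
      (add (Gen-difference onVars p) (Gen-difference onVars q))
    Gen-difference onVars (p ⊗ q) = resp (product-of-differences p q (bind φ p) (bind φ q))
      (add (mul p (Gen-difference onVars q)) (mul (bind φ q) (Gen-difference onVars p)))
    Gen-difference onVars (⊝ p) = resp (negated-difference p (bind φ p)) (Gen-⊝ (Gen-difference onVars p))

    Gen-via-substitution : (∀ x → Gen S (var x ⊕ ⊝ φ x)) → ∀ e → Gen S (bind φ e) → Gen S e
    Gen-via-substitution onVars e image = resp (begin
      (e ⊕ ⊝ bind φ e) ⊕ bind φ e  ≈⟨ ⊕-assoc e _ _ ⟩
      e ⊕ (⊝ bind φ e ⊕ bind φ e)  ≈⟨ ⊕-cong ≋-refl (⊕-invˡ _) ⟩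
      e ⊕ con 0#                   ≈⟨ +-identityʳ e ⟩
      e                            ∎)
      (add (Gen-difference onVars e) image)

  arcWeight : ∀ {k} → SignedMultidigraph k → Fin k → Fin k → Carrier
  arcWeight H x y = signR (σ H x y) (natR (m H x y))

  Laplacian-diag : ∀ {k} (H : SignedMultidigraph k) x → Laplacian H x x ≡ var x
  Laplacian-diag H x with x FP.≟ x
  ... | yes _ = refl
  ... | no x≢x = ⊥-elim (x≢x refl)

  Laplacian-off : ∀ {k} (H : SignedMultidigraph k) x y → ¬ (x ≡ y) →
    Laplacian H x y ≡ ⊝ con (arcWeight H x y)
  Laplacian-off H x y x≢y with x FP.≟ y
  ... | yes x≡y = ⊥-elim (x≢y x≡y)
  ... | no _ = refl

  evalAt-v : ∀ {k} (v : Fin k) a → evalAt v a v ≡ con a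
  evalAt-v v a with v FP.≟ v
  ... | yes _ = refl
  ... | no v≢v = ⊥-elim (v≢v refl)

  evalAt-other : ∀ {k} (v : Fin k) a u → ¬ (u ≡ v) → evalAt v a u ≡ var (inject₁ u)
  evalAt-other v a u u≢v with u FP.≟ v
  ... | yes u≡v = ⊥-elim (u≢v u≡v)
  ... | no _ = refl

  module Replicated {n : ℕ} (G : SignedMultidigraph n) (v : Fin n) where
    open import Relation.Binary.Reasoning.Setoid (CommutativeRing.setoid (polyRing (Fin (suc n))))

    private
      W = Fin (suc n)

    origin-inject₁ : ∀ u → origin v (inject₁ u) ≡ u
    origin-inject₁ u with toℕ (inject₁ u) N.<? n
    ... | yes lt = P.trans (FP.fromℕ<-cong (toℕ (inject₁ u)) (toℕ u) (FP.toℕ-inject₁ u) lt (FP.toℕ<n u))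
                           (FP.fromℕ<-toℕ u (FP.toℕ<n u))
    ... | no ¬lt = ⊥-elim (¬lt (P.subst (N._< n) (P.sym (FP.toℕ-inject₁ u)) (FP.toℕ<n u)))

    origin-fromℕ : origin v (fromℕ n) ≡ v
    origin-fromℕ with toℕ (fromℕ n) N.<? n
    ... | yes lt = ⊥-elim (NP.<-irrefl (FP.toℕ-fromℕ n) lt)
    ... | no _ = refl

    vertexCases : ∀ (x : W) → (x ≡ fromℕ n) ⊎ Σ (Fin n) (λ u → x ≡ inject₁ u)
    vertexCases = cases n
      where
      cases : ∀ k (x : Fin (suc k)) → (x ≡ fromℕ k) ⊎ Σ (Fin k) (λ u → x ≡ inject₁ u)
      cases zero zero = inj₁ refl
      cases (suc k) zero = inj₂ (zero , refl)
      cases (suc k) (suc x) with cases k x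
      ... | inj₁ e = inj₁ (P.cong suc e)
      ... | inj₂ (u , e) = inj₂ (suc u , P.cong suc e)

    twins-are-v : ∀ x y → ¬ (x ≡ y) → origin v x ≡ origin v y → origin v x ≡ v
    twins-are-v x y x≢y same with vertexCases x | vertexCases y
    ... | inj₁ refl | _ = origin-fromℕ
    ... | inj₂ (u , refl) | inj₁ refl = P.trans same origin-fromℕ
    ... | inj₂ (u , refl) | inj₂ (w , refl) = ⊥-elim (x≢y (P.cong inject₁
      (P.trans (P.sym (origin-inject₁ u)) (P.trans same (origin-inject₁ w)))))

    not-v⇒inject₁ : ∀ x → ¬ (origin v x ≡ v) → x ≡ inject₁ (origin v x)
    not-v⇒inject₁ x not-v with vertexCases x
    ... | inj₁ refl = ⊥-elim (not-v origin-fromℕ)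
    ... | inj₂ (u , refl) = P.cong inject₁ (P.sym (origin-inject₁ u))

    replicate-twins : ∀ x y → origin v x ≡ origin v y →
      arcWeight (replicate G v) x y ≡ 1# + 0#
    replicate-twins x y same with origin v x FP.≟ origin v y
    ... | yes _ = refl
    ... | no different = ⊥-elim (different same)

    replicate-others : ∀ x y → ¬ (origin v x ≡ origin v y) →
      arcWeight (replicate G v) x y ≡ arcWeight G (origin v x) (origin v y)
    replicate-others x y different with origin v x FP.≟ origin v y
    ... | yes same = ⊥-elim (different same)
    ... | no _ = refl

    restrict : Fin n → Expr W
    restrict = evalAt v (- 1#)

    K : Fin n → Fin n → Expr W
    K u w = bind restrict (Laplacian G u w)

    L : W → W → Expr W
    L = Laplacian (replicate G v)

    collapse : W → Expr W
    collapse x = restrict (origin v x)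

    collapse-twin : ∀ x → origin v x ≡ v → collapse x ≡ con (- 1#)
    collapse-twin x is-v = P.trans (P.cong restrict is-v) (evalAt-v v (- 1#))

    collapse-other : ∀ x → ¬ (origin v x ≡ v) → collapse x ≡ var x
    collapse-other x not-v =
      P.trans (evalAt-other v (- 1#) (origin v x) not-v) (P.cong var (P.sym (not-v⇒inject₁ x not-v)))

    K-vv : K v v ≡ con (- 1#)
    K-vv = P.trans (P.cong (bind restrict) (Laplacian-diag G v)) (evalAt-v v (- 1#))

    minus-one : ⊝ con (1# + 0#) ≋ con {W} (- 1#)
    minus-one = ≋-trans (⊝-cong (con-cong (CommutativeRing.+-identityʳ R 1#))) (≋-sym (con-neg 1#))

    collapse-Laplacian : ∀ x y → bind collapse (L x y) ≋ K (origin v x) (origin v y)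
    collapse-Laplacian x y with x FP.≟ y
    ... | yes refl = ≡⇒≋ (P.cong (bind restrict) (P.sym (Laplacian-diag G (origin v x))))
    ... | no x≢y = offDiagonal (origin v x FP.≟ origin v y)
      where
      offDiagonal : Dec (origin v x ≡ origin v y) →
        ⊝ con (arcWeight (replicate G v) x y) ≋ K (origin v x) (origin v y)
      offDiagonal (yes same) = begin
        ⊝ con (arcWeight (replicate G v) x y)  ≡⟨ P.cong (⊝_ ∘ con) (replicate-twins x y same) ⟩
        ⊝ con (1# + 0#)                        ≈⟨ minus-one ⟩
        con (- 1#)                             ≡⟨ P.sym K-vv ⟩
        K v v                                  ≡⟨ P.cong₂ K (P.sym x-is-v) (P.sym (P.trans (P.sym same) x-is-v)) ⟩
        K (origin v x) (origin v y)            ∎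
        where
        x-is-v : origin v x ≡ v
        x-is-v = twins-are-v x y x≢y same
      offDiagonal (no different) = ≡⇒≋ (P.trans (P.cong (⊝_ ∘ con) (replicate-others x y different))
        (P.sym (P.cong (bind restrict) (Laplacian-off G (origin v x) (origin v y) different))))

    collapse-fixes : ∀ x y → ¬ (x ≡ y × origin v x ≡ v) → bind collapse (L x y) ≡ L x y
    collapse-fixes x y not-vv with x FP.≟ y
    ... | yes refl = collapse-other x (λ is-v → not-vv (refl , is-v))
    ... | no _ = refl

    -- Column w of K is column  liftColumn w  of L, restricted to the rows of G.
    liftColumn : Fin n → W
    liftColumn w with w FP.≟ v
    ... | yes _ = fromℕ n
    ... | no _ = inject₁ w

    origin-liftColumn : ∀ w → origin v (liftColumn w) ≡ w
    origin-liftColumn w with w FP.≟ v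
    ... | yes w≡v = P.trans origin-fromℕ (P.sym w≡v)
    ... | no _ = origin-inject₁ w

    liftColumn-off-diagonal : ∀ u w → ¬ (inject₁ u ≡ liftColumn w × origin v (inject₁ u) ≡ v)
    liftColumn-off-diagonal u w (same , is-v) with w FP.≟ v
    ... | yes _ = FP.fromℕ≢inject₁ (P.sym same)
    ... | no w≢v = w≢v (P.trans (P.sym (FP.inject₁-injective same)) (P.trans (P.sym (origin-inject₁ u)) is-v))

    K-submatrix : ∀ u w → K u w ≋ L (inject₁ u) (liftColumn w)
    K-submatrix u w = begin
      K u w
        ≡⟨ P.sym (P.cong₂ K (origin-inject₁ u) (origin-liftColumn w)) ⟩
      K (origin v (inject₁ u)) (origin v (liftColumn w))
        ≈⟨ ≋-sym (collapse-Laplacian (inject₁ u) (liftColumn w)) ⟩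
      bind collapse (L (inject₁ u) (liftColumn w))
        ≡⟨ collapse-fixes (inject₁ u) (liftColumn w) (liftColumn-off-diagonal u w) ⟩
      L (inject₁ u) (liftColumn w) ∎

    collapse-restrict : ∀ u → bind collapse (restrict u) ≋ restrict u
    collapse-restrict u with u FP.≟ v
    ... | yes _ = ≋-refl
    ... | no u≢v =
      ≡⇒≋ (collapse-other (inject₁ u) (λ is-v → u≢v (P.trans (P.sym (origin-inject₁ u)) is-v)))

    module _ (j : ℕ) where
      open CommutativeRing (polyRing W) using (-‿inverseʳ)
      open Algebra.Properties.Ring (CommutativeRing.ring (polyRing W)) using (-‿involutive)

      Restricted : Expr W → Set (c ⊔ ℓ)
      Restricted = Restrict v (- 1#) (CriticalIdeal G j)

      RestrictionOf : Expr W → Set (c ⊔ ℓ)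
      RestrictionOf p = Σ (Expr (Fin n)) λ q → CriticalIdeal G j q × (p ≡ bind restrict q)

      Target : Expr W → Set (c ⊔ ℓ)
      Target p = (p ≡ var (inject₁ v) ⊕ con 1#) ⊎ (p ≡ var (fromℕ n) ⊕ con 1#) ⊎ Restricted p

      minorOfK-restricted : ∀ p → IsMinor K j p → Restricted p
      minorOfK-restricted p (rows , cols , rows-inc , cols-inc , refl) =
        resp (bind-det restrict j (λ a b → Laplacian G (rows a) (cols b)))
          (gen (_ , gen (rows , cols , rows-inc , cols-inc , refl) , refl))

      collapse-moves : ∀ x → Gen Target (var x ⊕ ⊝ collapse x)
      collapse-moves x = byCase (origin v x FP.≟ v)
        where
        generator : origin v x ≡ v → (x ≡ fromℕ n) ⊎ Σ (Fin n) (λ u → x ≡ inject₁ u) →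
          Target (var x ⊕ con 1#)
        generator is-v (inj₁ refl) = inj₂ (inj₁ refl)
        generator is-v (inj₂ (u , refl)) =
          inj₁ (P.cong (λ w → var (inject₁ w) ⊕ con 1#) (P.trans (P.sym (origin-inject₁ u)) is-v))
        byCase : Dec (origin v x ≡ v) → Gen Target (var x ⊕ ⊝ collapse x)
        byCase (yes is-v) = resp (⊕-cong ≋-refl one≋) (gen (generator is-v (vertexCases x)))
          where
          one≋ : con 1# ≋ ⊝ collapse x
          one≋ = ≋-trans (≋-sym (-‿involutive (con 1#)))
                   (⊝-cong (≋-trans (≋-sym (con-neg 1#)) (≡⇒≋ (P.sym (collapse-twin x is-v)))))
        byCase (no not-v) = resp (≋-trans (≋-sym (-‿inverseʳ (var x)))
                                   (⊕-cong ≋-refl (⊝-cong (≡⇒≋ (P.sym (collapse-other x not-v))))))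
                                 gen-0

      -- Every j-minor D of L lies in the target ideal, because  collapse(D)  is
      -- a j×j determinant of K (collapse-Laplacian) and collapse-moves.
      minor-inTarget : ∀ q → IsMinor L j q → Gen Target q
      minor-inTarget q (rows , cols , _ , _ , refl) = Gen-via-substitution collapse collapse-moves D collapsed
        where
        D = det j (λ a b → L (rows a) (cols b))
        collapsed : Gen Target (bind collapse D)
        collapsed = resp (≋-sym (≋-trans (bind-det collapse j (λ a b → L (rows a) (cols b)))
                                         (det-cong j (λ a b → collapse-Laplacian (rows a) (cols b)))))
          (Gen-mono (λ p minor → gen (inj₂ (inj₂ (minorOfK-restricted p minor))))
            (det-inMinorIdeal K j (λ a → origin v (rows a)) (λ b → origin v (cols b))))

      critical⊆target : ∀ q → CriticalIdeal (replicate G v) j q → Gen Target q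
      critical⊆target q = Gen-mono minor-inTarget

      collapse-target : ∀ {p} → Gen Target p → Restricted (bind collapse p)
      collapse-target = Gen-bind collapse onGenerator
        where
        plusOne-vanishes : ∀ x → origin v x ≡ v → Restricted (collapse x ⊕ con 1#)
        plusOne-vanishes x is-v rewrite collapse-twin x is-v =
          resp (≋-sym (≋-trans (⊕-cong (con-neg 1#) ≋-refl) (⊕-invˡ _))) gen-0
        onRestricted : ∀ p → RestrictionOf p → Restricted (bind collapse p)
        onRestricted p (q , q∈I , refl) =
          resp (≋-sym (≋-trans (≡⇒≋ (bind-bind collapse restrict q)) (bind-ext collapse-restrict q)))
               (gen (q , q∈I , refl))
        onGenerator : ∀ p → Target p → Restricted (bind collapse p)
        onGenerator p (inj₁ refl) = plusOne-vanishes (inject₁ v) (origin-inject₁ v)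
        onGenerator p (inj₂ (inj₁ refl)) = plusOne-vanishes (fromℕ n) origin-fromℕ
        onGenerator p (inj₂ (inj₂ r)) = Gen-bind collapse onRestricted r

      -- Conversely  I_j(G,X)|_{x_v = -1} ⊆ I_j(r(G,v),X):  by K-submatrix, the
      -- restriction of a j-minor of L(G,X) is a j×j determinant of L.
      restricted⊆critical : ∀ {p} → Restricted p → CriticalIdeal (replicate G v) j p
      restricted⊆critical = Gen-mono onGenerator
        where
        restrictedMinor : ∀ q → IsMinor (Laplacian G) j q → CriticalIdeal (replicate G v) j (bind restrict q)
        restrictedMinor q (rows , cols , _ , _ , refl) =
          resp (≋-sym (≋-trans (bind-det restrict j (λ a b → Laplacian G (rows a) (cols b)))
                               (det-cong j (λ a b → K-submatrix (rows a) (cols b)))))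
               (det-inMinorIdeal L j (inject₁ ∘ rows) (liftColumn ∘ cols))
        onGenerator : ∀ p → RestrictionOf p → CriticalIdeal (replicate G v) j p
        onGenerator p (q , q∈I , refl) = Gen-bind restrict restrictedMinor q∈I

-- Lemma 2.5: the inclusion is critical⊆target; triviality transfers forwards
-- by applying collapse to that inclusion (collapse fixes 1) and backwards by
-- restricted⊆critical.
lemma2p5 : ∀ {c ℓ} (R : CommutativeRing c ℓ) → IsPID R →
    let open CommutativeRing R
        open Poly R
    in ∀ (n : ℕ) → 2 ≤ n → (G : SignedMultidigraph n) (v : Fin n) (j : ℕ) → 1 ≤ j → j ≤ n →
      (∀ q → CriticalIdeal (replicate G v) j q →
        Gen (λ p → (p ≡ var (inject₁ v) ⊕ con 1#)
                 ⊎ (p ≡ var (fromℕ n) ⊕ con 1#)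
                 ⊎ Restrict v (- 1#) (CriticalIdeal G j) p) q)
      × (Trivial (CriticalIdeal (replicate G v) j)
          ⇔ Trivial (Restrict v (- 1#) (CriticalIdeal G j)))
lemma2p5 R _ n _ G v j _ _ =
  critical⊆target j ,
  mk⇔ (λ one∈I → collapse-target j (critical⊆target j _ one∈I)) (restricted⊆critical j)
  where
  open Replication.Replicated R G v
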